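{- Let $G$ be a split graph, i.e. a graph whose vertex set can be partitioned into a clique $K$ and an independent set $I$. Then $\operatorname{car}(G)\leq 2$.
   Context: All graphs are finite, simple and undirected; $G[X]$ denotes the subgraph induced by $X$. A set $S\subseteq V(G)$ is cycle convex if for every $u\in V(G)\setminus S$ the graph $G[S\cup\{u\}]$ contains no cycle passing through $u$. The cycle convex hull $\langle S\rangle$ is the smallest cycle convex set containing $S$. A set $S$ is Carathéodory independent if there is $p\in\langle S\rangle$ with $p\notin \bigcup_{a\in S}\langle S\setminus\{a\}\rangle$. The Carathéodory number $\operatorname{car}(G)$ is the maximum cardinality of a Carathéodory independent set of $G$. -}

module Defs where

open import Data.Nat using (ℕ; _≤_)
open import Data.Fin using (Fin)
open import Data.Fin.Subset using (Subset; _∈_; _∉_; _⊆_; _-_; ∣_∣; _∪_; ⁅_⁆)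
open import Data.List using (List; []; _∷_; length; head; last)
open import Data.List.Relation.Unary.All using (All)
open import Data.List.Relation.Unary.Unique.Propositional using (Unique)
open import Data.List.Membership.Propositional using () renaming (_∈_ to _∈ₗ_)
open import Data.Maybe using (just)
open import Data.Product using (Σ; _×_; ∃; ∃-syntax)
open import Data.Sum using (_⊎_)
open import Relation.Binary.PropositionalEquality using (_≡_)
open import Relation.Nullary using (¬_)
open import Data.Empty using (⊥)


record Graph (n : ℕ) : Set₁ where
  field
    Adj     : Fin n → Fin n → Set
    sym     : ∀ {u v} → Adj u v → Adj v u
    irrefl  : ∀ {u} → ¬ Adj u u

open Graph public

module _ {n : ℕ} (G : Graph n) where

  data Path : List (Fin n) → Set where
    p[]  : Path []
    p[_] : ∀ v → Path (v ∷ [])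
    p∷   : ∀ {u v vs} → Adj G u v → Path (v ∷ vs) → Path (u ∷ v ∷ vs)

  record Cycle (cs : List (Fin n)) : Set where
    field
      distinct : Unique cs
      long     : 3 ≤ length cs
      path     : Path cs
      closing  : ∀ {a b} → head cs ≡ just a → last cs ≡ just b → Adj G b a

  CycleThroughIn : Subset n → Fin n → Set
  CycleThroughIn X u =
    ∃[ cs ] (Cycle cs × All (_∈ X) cs × u ∈ₗ cs)

  CycleConvex : Subset n → Set
  CycleConvex S = ∀ u → u ∉ S → ¬ CycleThroughIn (S ∪ ⁅ u ⁆) u

  -- p ∈ ⟨S⟩: the cycle convex hull is the smallest cycle convex set
  -- containing S, i.e. the intersection of all cycle convex supersets of S.
  InHull : Subset n → Fin n → Set
  InHull S p = ∀ C → CycleConvex C → S ⊆ C → p ∈ C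

  CaratheodoryIndependent : Subset n → Set
  CaratheodoryIndependent S =
    ∃[ p ] (InHull S p × (∀ a → a ∈ S → ¬ InHull (S - a) p))

  CarAtMost : ℕ → Set
  CarAtMost k = ∀ S → CaratheodoryIndependent S → ∣ S ∣ ≤ k

  IsClique : Subset n → Set
  IsClique K = ∀ u v → u ∈ K → v ∈ K → ¬ u ≡ v → Adj G u v

  IsIndependent : Subset n → Set
  IsIndependent I = ∀ u v → u ∈ I → v ∈ I → ¬ Adj G u v

  IsSplit : Set
  IsSplit = ∃[ K ] ∃[ I ]
    ((∀ v → v ∈ K ⊎ v ∈ I) × (∀ v → v ∈ K → v ∈ I → ⊥)
     × IsClique K × IsIndependent I)

module Submission where

-- Let S be Carathéodory independent with witness p and |S| ≥ 3. For c ∈ S, p ∉ ⟨S - c⟩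
-- yields a cycle convex C ⊇ S - c missing both c and p. Such a C never contains the
-- clique K: if c ∈ K this is immediate, and if c ∈ I then all neighbours of c lie in
-- K ⊆ C, so two of them would close a triangle with c and force c into C; hence c has
-- at most one neighbour, C ∪ {c} is a cycle convex superset of S, and p ∈ C. Conversely,
-- closing triangles shows that a cycle convex set containing two vertices of K contains
-- all of K. Taking c outside two suitable vertices of S, this makes S itself cycle
-- convex, so p ∈ S, which is impossible.

open import Data.Nat using (ℕ; _≤_; _<_; _≤?_; z≤n; s≤s; _+_)
open import Data.Nat.Properties using (≤⇒≯; ≤-trans; ≤-reflexive; +-suc; +-monoʳ-≤; n≤1+n; ≰⇒>)
open import Data.Bool using (true; false)
open import Data.Vec using (_∷_; [])
open import Data.Fin using (Fin)
open import Data.Fin.Properties using (_≟_; any?)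
open import Data.Fin.Subset using (Subset; _∈_; _∉_; _⊆_; _-_; ∣_∣; _∪_; ⁅_⁆)
open import Data.Fin.Subset.Properties
  using (_∈?_; ⊆-refl; x∈p∪q⁻; x∈p∪q⁺; x∈⁅x⁆; x∈⁅y⁆⇒x≡y; ∣⁅x⁆∣≡1; x∈p∧x≢y⇒x∈p-y; p⊆q⇒∣p∣≤∣q∣)
open import Data.List using ([]; _∷_; head; last)
open import Data.List.Relation.Unary.All as All using (All; []; _∷_)
open import Data.List.Relation.Unary.All.Properties using (¬Any⇒All¬)
open import Data.List.Relation.Unary.AllPairs using ([]; _∷_)
open import Data.List.Relation.Unary.Any using (here; there)
open import Data.List.Relation.Unary.Unique.Propositional using (Unique)
open import Data.List.Membership.Propositional using () renaming (_∈_ to _∈ₗ_)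
import Data.List.Membership.DecPropositional as DecMembership
open import Data.Maybe using (just)
open import Data.Product using (_×_; _,_; ∃₂; ∃-syntax)
open import Data.Sum using (_⊎_; inj₁; inj₂)
open import Data.Empty using (⊥; ⊥-elim)
open import Function using (_∘_)
import Relation.Binary.PropositionalEquality as ≡
open ≡ using (_≡_; _≢_; refl; cong₂; ≢-sym)
open import Relation.Nullary using (¬_; yes; no; contradiction)
open import Relation.Nullary.Decidable using (_×-dec_; ¬?)
open import Defs

∣p∪q∣≤∣p∣+∣q∣ : ∀ {n} (p q : Subset n) → ∣ p ∪ q ∣ ≤ ∣ p ∣ + ∣ q ∣
∣p∪q∣≤∣p∣+∣q∣ []          []          = z≤n
∣p∪q∣≤∣p∣+∣q∣ (true ∷ p)  (true ∷ q)  = s≤s (≤-trans (∣p∪q∣≤∣p∣+∣q∣ p q) (+-monoʳ-≤ ∣ p ∣ (n≤1+n ∣ q ∣)))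
∣p∪q∣≤∣p∣+∣q∣ (true ∷ p)  (false ∷ q) = s≤s (∣p∪q∣≤∣p∣+∣q∣ p q)
∣p∪q∣≤∣p∣+∣q∣ (false ∷ p) (true ∷ q)  = ≤-trans (s≤s (∣p∪q∣≤∣p∣+∣q∣ p q)) (≤-reflexive (≡.sym (+-suc ∣ p ∣ ∣ q ∣)))
∣p∪q∣≤∣p∣+∣q∣ (false ∷ p) (false ∷ q) = ∣p∪q∣≤∣p∣+∣q∣ p q

∣⁅x⁆∪⁅y⁆∣≤2 : ∀ {n} (x y : Fin n) → ∣ ⁅ x ⁆ ∪ ⁅ y ⁆ ∣ ≤ 2
∣⁅x⁆∪⁅y⁆∣≤2 x y = ≤-trans (∣p∪q∣≤∣p∣+∣q∣ ⁅ x ⁆ ⁅ y ⁆) (≤-reflexive (cong₂ _+_ (∣⁅x⁆∣≡1 x) (∣⁅x⁆∣≡1 y)))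

∃∈-∖-pair : ∀ {n} {p : Subset n} → 2 < ∣ p ∣ → ∀ x y → ∃[ z ] (z ∈ p × z ≢ x × z ≢ y)
∃∈-∖-pair {p = p} 2<∣p∣ x y with any? (λ z → z ∈? p ×-dec ¬? (z ≟ x) ×-dec ¬? (z ≟ y))
... | yes found = found
... | no none   = ⊥-elim (≤⇒≯ (≤-trans (p⊆q⇒∣p∣≤∣q∣ p⊆⁅x⁆∪⁅y⁆) (∣⁅x⁆∪⁅y⁆∣≤2 x y)) 2<∣p∣)
  where
  p⊆⁅x⁆∪⁅y⁆ : p ⊆ ⁅ x ⁆ ∪ ⁅ y ⁆
  p⊆⁅x⁆∪⁅y⁆ {z} z∈p with z ≟ x | z ≟ y
  ... | yes refl | _        = x∈p∪q⁺ (inj₁ (x∈⁅x⁆ z))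
  ... | no _     | yes refl = x∈p∪q⁺ (inj₂ (x∈⁅x⁆ z))
  ... | no z≢x   | no z≢y   = ⊥-elim (none (z , z∈p , z≢x , z≢y))

x∈p∪⁅y⁆∧x≢y⇒x∈p : ∀ {n} {p : Subset n} {x y} → x ∈ p ∪ ⁅ y ⁆ → x ≢ y → x ∈ p
x∈p∪⁅y⁆∧x≢y⇒x∈p {p = p} {y = y} x∈ x≢y with x∈p∪q⁻ p ⁅ y ⁆ x∈
... | inj₁ x∈p   = x∈p
... | inj₂ x∈⁅y⁆ = contradiction (x∈⁅y⁆⇒x≡y y x∈⁅y⁆) x≢y

p-x⊆q⇒p⊆q∪⁅x⁆ : ∀ {n} {p q : Subset n} {x} → p - x ⊆ q → p ⊆ q ∪ ⁅ x ⁆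
p-x⊆q⇒p⊆q∪⁅x⁆ {x = x} p-x⊆q {y} y∈p with y ≟ x
... | yes refl = x∈p∪q⁺ (inj₂ (x∈⁅x⁆ y))
... | no y≢x   = x∈p∪q⁺ (inj₁ (p-x⊆q (x∈p∧x≢y⇒x∈p-y y∈p y≢x)))

module _ {n : ℕ} (G : Graph n) where

  open DecMembership (_≟_ {n}) using () renaming (_∈?_ to _∈ₗ?_)

  adj⇒≢ : ∀ {u v} → Adj G u v → u ≢ v
  adj⇒≢ u~v refl = irrefl G u~v

  TwoNeighbours : (Fin n → Set) → Fin n → Set
  TwoNeighbours P v = ∃₂ λ x y → x ≢ y × P x × P y × Adj G v x × Adj G v y

  TwoNeighbours-map : ∀ {P Q : Fin n → Set} {v} → (∀ {x} → Adj G v x → P x → Q x) →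
                      TwoNeighbours P v → TwoNeighbours Q v
  TwoNeighbours-map f (x , y , x≢y , Px , Py , v~x , v~y) = x , y , x≢y , f v~x Px , f v~y Py , v~x , v~y

  HasNeighbourIn : Subset n → Fin n → Set
  HasNeighbourIn X v = ∃[ w ] (w ∈ X × Adj G v w)

  AtMostOneNeighbour : Fin n → Set
  AtMostOneNeighbour v = ∀ {x y} → Adj G v x → Adj G v y → x ≡ y

  second-vertex-neighbours : ∀ {u w ws} → Adj G u w → Path G (w ∷ ws) → All (u ≢_) (w ∷ ws) →
                             last (u ∷ w ∷ ws) ≡ just w ⊎ TwoNeighbours (_∈ₗ u ∷ w ∷ ws) w
  second-vertex-neighbours u~w p[ _ ]            _             = inj₁ refl
  second-vertex-neighbours {u} u~w (p∷ {v = z} w~z _) (_ ∷ u≢z ∷ _) =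
    inj₂ (u , z , u≢z , here refl , there (there (here refl)) , sym G u~w , w~z)

  path-neighbours : ∀ {xs v} → Path G xs → Unique xs → v ∈ₗ xs →
                    head xs ≡ just v ⊎ last xs ≡ just v ⊎ TwoNeighbours (_∈ₗ xs) v
  path-neighbours _ _ (here refl) = inj₁ refl
  path-neighbours (p∷ u~w q) (u∉ws ∷ uniq) (there v∈) with path-neighbours q uniq v∈
  ... | inj₁ refl              = inj₂ (second-vertex-neighbours u~w q u∉ws)
  ... | inj₂ (inj₁ last≡v)     = inj₂ (inj₁ last≡v)
  ... | inj₂ (inj₂ (x , y , x≢y , x∈ , y∈ , v~x , v~y)) =
    inj₂ (inj₂ (x , y , x≢y , there x∈ , there y∈ , v~x , v~y))

  last-∈ : ∀ (x : Fin n) xs → ∃[ b ] (last (x ∷ xs) ≡ just b × b ∈ₗ x ∷ xs)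
  last-∈ x []       = x , refl , here refl
  last-∈ x (y ∷ ys) with last-∈ y ys
  ... | b , last≡b , b∈ = b , last≡b , there b∈

  predecessor-of-last : ∀ {x y ys b} → Path G (x ∷ y ∷ ys) → last (x ∷ y ∷ ys) ≡ just b →
                        ∃[ a ] (a ∈ₗ x ∷ y ∷ ys × Adj G a b)
  predecessor-of-last {x} {ys = []}    (p∷ x~y _) refl    = x , here refl , x~y
  predecessor-of-last     {ys = _ ∷ _} (p∷ _ q)   last≡b with predecessor-of-last q last≡b
  ... | a , a∈ , a~b = a , there a∈ , a~b

  cycle-neighbours : ∀ {cs v} → Cycle G cs → v ∈ₗ cs → TwoNeighbours (_∈ₗ cs) v
  cycle-neighbours {[]}          record { long = () }
  cycle-neighbours {_ ∷ []}      record { long = s≤s () }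
  cycle-neighbours {_ ∷ _ ∷ []}  record { long = s≤s (s≤s ()) }
  cycle-neighbours {a ∷ s ∷ t ∷ rest} c v∈
    with Cycle.distinct c | Cycle.path c | path-neighbours (Cycle.path c) (Cycle.distinct c) v∈
  ... | _ | _ | inj₂ (inj₂ neighbours) = neighbours
  ... | _ ∷ s∉ ∷ _ | p∷ a~s _ | inj₁ refl with last-∈ t rest
  ...   | b , last≡b , b∈ =
    s , b , All.lookup s∉ b∈ , there (here refl) , there (there b∈) , a~s , sym G (Cycle.closing c refl last≡b)
  cycle-neighbours {a ∷ s ∷ t ∷ rest} c v∈ | a∉ ∷ _ | p∷ _ path | inj₂ (inj₁ last≡v)
    with predecessor-of-last path last≡v
  ... | u , u∈ , u~v = a , u , All.lookup a∉ u∈ , here refl , there u∈ , Cycle.closing c refl last≡v , sym G u~v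

  cycle-through-neighbours : ∀ {X u} → CycleThroughIn G (X ∪ ⁅ u ⁆) u →
                             TwoNeighbours (λ x → x ∈ X × HasNeighbourIn X x) u
  cycle-through-neighbours {X} {u} (cs , cycle , cs⊆X∪u , u∈cs) =
    TwoNeighbours-map on-cycle (cycle-neighbours cycle u∈cs)
    where
    in-X : ∀ {z} → z ∈ₗ cs → z ≢ u → z ∈ X
    in-X z∈cs = x∈p∪⁅y⁆∧x≢y⇒x∈p (All.lookup cs⊆X∪u z∈cs)

    neighbour-in-X : ∀ {x} → x ∈ₗ cs → HasNeighbourIn X x
    neighbour-in-X x∈cs with cycle-neighbours cycle x∈cs
    ... | y , z , y≢z , y∈cs , z∈cs , x~y , x~z with y ≟ u
    ...   | yes refl = z , in-X z∈cs (≢-sym y≢z) , x~z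
    ...   | no y≢u   = y , in-X y∈cs y≢u , x~y

    on-cycle : ∀ {x} → Adj G u x → x ∈ₗ cs → x ∈ X × HasNeighbourIn X x
    on-cycle u~x x∈cs = in-X x∈cs (≢-sym (adj⇒≢ u~x)) , neighbour-in-X x∈cs

  triangle-closed : ∀ {C u x y} → CycleConvex G C → x ∈ C → y ∈ C →
                    Adj G u x → Adj G u y → Adj G x y → u ∈ C
  triangle-closed {C} {u} {x} {y} convex x∈C y∈C u~x u~y x~y with u ∈? C
  ... | yes u∈C = u∈C
  ... | no u∉C  = ⊥-elim (convex u u∉C (u ∷ x ∷ y ∷ [] , triangle , in-C∪u , here refl))
    where
    triangle : Cycle G (u ∷ x ∷ y ∷ [])
    triangle = record
      { distinct = (adj⇒≢ u~x ∷ adj⇒≢ u~y ∷ []) ∷ (adj⇒≢ x~y ∷ []) ∷ [] ∷ []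
      ; long     = s≤s (s≤s (s≤s z≤n))
      ; path     = p∷ u~x (p∷ x~y p[ y ])
      ; closing  = λ { refl refl → sym G u~y }
      }
    in-C∪u : All (_∈ C ∪ ⁅ u ⁆) (u ∷ x ∷ y ∷ [])
    in-C∪u = x∈p∪q⁺ (inj₂ (x∈⁅x⁆ u)) ∷ x∈p∪q⁺ (inj₁ x∈C) ∷ x∈p∪q⁺ (inj₁ y∈C) ∷ []

  clique-⊆-cycleConvex : ∀ {K C k₁ k₂} → IsClique G K → CycleConvex G C → k₁ ≢ k₂ →
                         k₁ ∈ K → k₂ ∈ K → k₁ ∈ C → k₂ ∈ C → K ⊆ C
  clique-⊆-cycleConvex {k₁ = k₁} {k₂} clique convex k₁≢k₂ k₁∈K k₂∈K k₁∈C k₂∈C {w} w∈K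
    with w ≟ k₁ | w ≟ k₂
  ... | yes refl | _        = k₁∈C
  ... | no _     | yes refl = k₂∈C
  ... | no w≢k₁  | no w≢k₂  = triangle-closed convex k₁∈C k₂∈C
    (clique w k₁ w∈K k₁∈K w≢k₁) (clique w k₂ w∈K k₂∈K w≢k₂) (clique k₁ k₂ k₁∈K k₂∈K k₁≢k₂)

  cycleConvex-∪-leaf : ∀ {C w} → CycleConvex G C → AtMostOneNeighbour w → CycleConvex G (C ∪ ⁅ w ⁆)
  cycleConvex-∪-leaf {C} {w} convex leaf u u∉ (cs , cycle , cs⊆ , u∈cs) with w ∈ₗ? cs
  ... | yes w∈cs with cycle-neighbours cycle w∈cs
  ...   | _ , _ , x≢y , _ , _ , w~x , w~y = x≢y (leaf w~x w~y)
  cycleConvex-∪-leaf {C} {w} convex leaf u u∉ (cs , cycle , cs⊆ , u∈cs) | no w∉cs =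
    convex u (u∉ ∘ x∈p∪q⁺ ∘ inj₁) (cs , cycle , All.zipWith drop-w (cs⊆ , ¬Any⇒All¬ cs w∉cs) , u∈cs)
    where
    drop-w : ∀ {z} → z ∈ (C ∪ ⁅ w ⁆) ∪ ⁅ u ⁆ × w ≢ z → z ∈ C ∪ ⁅ u ⁆
    drop-w (z∈ , w≢z) with x∈p∪q⁻ _ ⁅ u ⁆ z∈
    ... | inj₁ z∈C∪w = x∈p∪q⁺ (inj₁ (x∈p∪⁅y⁆∧x≢y⇒x∈p z∈C∪w (≢-sym w≢z)))
    ... | inj₂ z∈⁅u⁆ = x∈p∪q⁺ (inj₂ z∈⁅u⁆)

  inHull-minus : ∀ {S p} a → InHull G S p →
                 (∀ C → CycleConvex G C → S - a ⊆ C → a ∉ C → p ∉ C → ⊥) → InHull G (S - a) p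
  inHull-minus {S} {p} a p∈⟨S⟩ no-separator C convex S-a⊆C with p ∈? C
  ... | yes p∈C = p∈C
  ... | no p∉C  = ⊥-elim (no-separator C convex S-a⊆C a∉C p∉C)
    where
    a∉C : a ∉ C
    a∉C a∈C = p∉C (p∈⟨S⟩ C convex S⊆C)
      where
      S⊆C : S ⊆ C
      S⊆C {x} x∈S with x ≟ a
      ... | yes refl = a∈C
      ... | no x≢a   = S-a⊆C (x∈p∧x≢y⇒x∈p-y x∈S x≢a)

module SplitGraph {n : ℕ} (G : Graph n) (K I : Subset n) (cover : ∀ v → v ∈ K ⊎ v ∈ I)
                  (clique : IsClique G K) (independent : IsIndependent G I) where

  neighbour-of-independent∈K : ∀ {c y} → c ∈ I → Adj G c y → y ∈ K
  neighbour-of-independent∈K {c} {y} c∈I c~y with cover y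
  ... | inj₁ y∈K = y∈K
  ... | inj₂ y∈I = ⊥-elim (independent c y c∈I y∈I c~y)

  cycleConvex-∪-independent : ∀ {C c} → CycleConvex G C → K ⊆ C → c ∈ I → c ∉ C →
                              CycleConvex G (C ∪ ⁅ c ⁆)
  cycleConvex-∪-independent {C} {c} convex K⊆C c∈I c∉C = cycleConvex-∪-leaf G convex leaf
    where
    leaf : AtMostOneNeighbour G c
    leaf {x} {y} c~x c~y with x ≟ y
    ... | yes x≡y = x≡y
    ... | no x≢y  = contradiction (triangle-closed G convex (K⊆C x∈K) (K⊆C y∈K) c~x c~y (clique x y x∈K y∈K x≢y)) c∉C
      where
      x∈K = neighbour-of-independent∈K c∈I c~x
      y∈K = neighbour-of-independent∈K c∈I c~y

  module CaratheodoryIndependent {S p} (p∈⟨S⟩ : InHull G S p) (p∉⟨S-a⟩ : ∀ a → a ∈ S → ¬ InHull G (S - a) p)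
                                 (2<∣S∣ : 2 < ∣ S ∣) where

    p∉S : p ∉ S
    p∉S p∈S with ∃∈-∖-pair 2<∣S∣ p p
    ... | c , c∈S , c≢p , _ = p∉⟨S-a⟩ c c∈S (λ C _ S-c⊆C → S-c⊆C (x∈p∧x≢y⇒x∈p-y p∈S (≢-sym c≢p)))

    ¬separator-⊇-clique : ∀ {c C} → c ∈ S → CycleConvex G C → S - c ⊆ C → c ∉ C → p ∉ C → ¬ K ⊆ C
    ¬separator-⊇-clique {c} {C} c∈S convex S-c⊆C c∉C p∉C K⊆C with cover c
    ... | inj₁ c∈K = c∉C (K⊆C c∈K)
    ... | inj₂ c∈I = p∉C (x∈p∪⁅y⁆∧x≢y⇒x∈p p∈C∪c p≢c)
      where
      p∈C∪c : p ∈ C ∪ ⁅ c ⁆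
      p∈C∪c = p∈⟨S⟩ (C ∪ ⁅ c ⁆) (cycleConvex-∪-independent convex K⊆C c∈I c∉C) (p-x⊆q⇒p⊆q∪⁅x⁆ S-c⊆C)
      p≢c : p ≢ c
      p≢c refl = p∉S c∈S

    ¬clique-forced : ∀ {c} → c ∈ S → ¬ (∀ {C} → CycleConvex G C → S - c ⊆ C → K ⊆ C)
    ¬clique-forced {c} c∈S forced = p∉⟨S-a⟩ c c∈S (inHull-minus G c p∈⟨S⟩ λ C convex S-c⊆C c∉C p∉C →
      ¬separator-⊇-clique c∈S convex S-c⊆C c∉C p∉C (forced convex S-c⊆C))

    ¬distinct-clique-members : ∀ {k₁ k₂} → k₁ ≢ k₂ → k₁ ∈ S → k₂ ∈ S → k₁ ∈ K → k₂ ∈ K → ⊥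
    ¬distinct-clique-members {k₁} {k₂} k₁≢k₂ k₁∈S k₂∈S k₁∈K k₂∈K with ∃∈-∖-pair 2<∣S∣ k₁ k₂
    ... | t , t∈S , t≢k₁ , t≢k₂ = ¬clique-forced t∈S λ convex S-t⊆C →
      clique-⊆-cycleConvex G clique convex k₁≢k₂ k₁∈K k₂∈K
        (S-t⊆C (x∈p∧x≢y⇒x∈p-y k₁∈S (≢-sym t≢k₁))) (S-t⊆C (x∈p∧x≢y⇒x∈p-y k₂∈S (≢-sym t≢k₂)))

    ¬outside-neighbour-of-independent : ∀ {u x} → u ∉ S → x ∈ S → x ∈ I → HasNeighbourIn G S x → ¬ Adj G u x
    ¬outside-neighbour-of-independent {u} {x} u∉S x∈S x∈I (x′ , x′∈S , x~x′) u~x with cover x′ | cover u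
    ... | inj₂ x′∈I | _         = independent x x′ x∈I x′∈I x~x′
    ... | _         | inj₂ u∈I  = independent u x u∈I x∈I u~x
    ... | inj₁ x′∈K | inj₁ u∈K with ∃∈-∖-pair 2<∣S∣ x x′
    ...   | t , t∈S , t≢x , t≢x′ = ¬clique-forced t∈S λ convex S-t⊆C →
      let x∈C  = S-t⊆C (x∈p∧x≢y⇒x∈p-y x∈S (≢-sym t≢x))
          x′∈C = S-t⊆C (x∈p∧x≢y⇒x∈p-y x′∈S (≢-sym t≢x′))
          u∈C  = triangle-closed G convex x′∈C x∈C (clique u x′ u∈K x′∈K u≢x′) u~x (sym G x~x′)
      in  clique-⊆-cycleConvex G clique convex u≢x′ u∈K x′∈K u∈C x′∈C
      where
      u≢x′ : u ≢ x′
      u≢x′ refl = u∉S x′∈S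

    S-cycleConvex : CycleConvex G S
    S-cycleConvex u u∉S cycle with cycle-through-neighbours G cycle
    ... | x , y , x≢y , (x∈S , x-linked) , (y∈S , y-linked) , u~x , u~y with cover x | cover y
    ...   | inj₂ x∈I | _        = ¬outside-neighbour-of-independent u∉S x∈S x∈I x-linked u~x
    ...   | inj₁ _   | inj₂ y∈I = ¬outside-neighbour-of-independent u∉S y∈S y∈I y-linked u~y
    ...   | inj₁ x∈K | inj₁ y∈K = ¬distinct-clique-members x≢y x∈S y∈S x∈K y∈K

proposition4p7 : (n : ℕ) (G : Graph n) → IsSplit G → CarAtMost G 2
proposition4p7 n G (K , I , cover , _ , clique , independent) S (p , p∈⟨S⟩ , p∉⟨S-a⟩) with ∣ S ∣ ≤? 2
... | yes ∣S∣≤2 = ∣S∣≤2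
... | no ∣S∣≰2  = ⊥-elim (p∉S (p∈⟨S⟩ S S-cycleConvex ⊆-refl))
  where
  open SplitGraph G K I cover clique independent
  open CaratheodoryIndependent p∈⟨S⟩ p∉⟨S-a⟩ (≰⇒> ∣S∣≰2)
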